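{- For $n\ge1$, the map $f$ is a bijection between $\mathrm{NC}^{\mathrm{NN}}(n)$ and $\mathrm{CT}_B(n)$.
   Context: $[n]=\{1,\dots,n\}$. An edge of a partition of $[n]$ is a pair $(i,j)$, $i<j$, in the same block with no element of that block strictly between. $\mathrm{NC}(n)$: partitions of $[n]$ with no two edges $(a,b),(c,d)$, $a<c<b<d$. A block $B$ is nonnested if no edge $(i,j)$ has $i<\min B\le\max B<j$. $\mathrm{NC}^{\mathrm{NN}}(n)$ is the set of pairs $(\sigma,X)$ with $\sigma\in\mathrm{NC}(n)$ and $X$ a set of nonnested blocks of $\sigma$. Tableaux. A Ferrers diagram is a left-justified arrangement of cells with weakly decreasing row lengths from top to bottom, where rows and columns may be empty; its length is the number of rows plus the number of columns. Traverse its southeast boundary from the northeast corner to the southwest corner and label the steps $1,\dots,n$; each step is either a south step (the right end of a row; the row gets that label) or a west step (the bottom of a column; the column gets that label). If $F$ has $k$ columns, the shifted diagram $\overline F$ is obtained by placing above $F$ new rows of lengths $1,2,\dots,k$ (from top to bottom), left-justified; the rightmost cell of a new row is its diagonal cell, and a new row whose diagonal cell lies in the column labelled $i$ is labelled $-i$. The $(i,j)$-entry is the cell in the row labelled $i$ and column labelled $j$. A permutation tableau of type $B_n$ is a $0,1$-filling of $\overline F$ for some Ferrers diagram $F$ of length $n$ such that (1) each column has at least one $1$; (2) no $0$ has both a $1$ above it in its column and a $1$ to its left in its row; (3) no $0$ in a diagonal cell has a $1$ to its left in its row. $\mathrm{CT}_B(n)$ is the set of permutation tableaux of type $B_n$ with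 exactly one $1$ in each column. The map $f$. For $(\sigma,X)\in\mathrm{NC}^{\mathrm{NN}}(n)$, let $F$ be the Ferrers diagram of length $n$ whose $i$-th boundary step is south iff $i$ is the minimum of a block of $\sigma$ not in $X$. Fill $\overline F$: for each $i$ that is the minimum of a block in $X$, put $1$ in the $(-i,i)$-entry; for each pair of distinct $i,j$ in a common block $B$ with $i=\min B$, put $1$ in the $(-i,j)$-entry if $B\in X$ and in the $(i,j)$-entry otherwise; all other cells get $0$. This filling is $f(\sigma,X)$. -}

module Defs where

open import Data.Nat using (ℕ; zero; suc; _≤_; _<_; _≡ᵇ_; _≤ᵇ_)
open import Data.Bool using (Bool; true; false; _∧_; _∨_; not)
open import Data.List using (List; []; _∷_; length; map; upTo)
open import Data.Maybe using (Maybe; just; nothing)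
open import Data.Product using (Σ; _×_; _,_)
open import Data.Unit using (⊤)
open import Data.Empty using (⊥)
open import Relation.Nullary using (¬_)
open import Relation.Binary.PropositionalEquality using (_≡_; _≢_)

-- 1-based indexing into lists (labels 1..n); out of range gives nothing

at : {A : Set} → List A → ℕ → Maybe A
at []       _             = nothing
at (x ∷ xs) zero          = nothing
at (x ∷ xs) (suc zero)    = just x
at (x ∷ xs) (suc (suc k)) = at xs (suc k)

atℕ : List ℕ → ℕ → ℕ
atℕ xs i with at xs i
... | just v  = v
... | nothing = 0

atB : List Bool → ℕ → Bool
atB xs i with at xs i
... | just v  = v
... | nothing = false

-- Set partitions of [n], encoded canonically by the list
-- (rep 1, ..., rep n) where rep i = minimum of the block containing i.

rep : List ℕ → ℕ → ℕ
rep = atℕ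

IsPartition : ℕ → List ℕ → Set
IsPartition n σ =
  length σ ≡ n ×
  (∀ i → 1 ≤ i → i ≤ n → 1 ≤ rep σ i × rep σ i ≤ i × rep σ (rep σ i) ≡ rep σ i)

SameBlock : List ℕ → ℕ → ℕ → Set
SameBlock σ i j = rep σ i ≡ rep σ j

Edge : ℕ → List ℕ → ℕ → ℕ → Set
Edge n σ i j =
  1 ≤ i × i < j × j ≤ n × SameBlock σ i j ×
  (∀ k → i < k → k < j → ¬ SameBlock σ i k)

NonCrossing : ℕ → List ℕ → Set
NonCrossing n σ = ∀ a b c d → Edge n σ a b → Edge n σ c d →
  a < c → c < b → b < d → ⊥

-- blocks are identified by their minimum m
IsBlockMin : ℕ → List ℕ → ℕ → Set
IsBlockMin n σ m = 1 ≤ m × m ≤ n × rep σ m ≡ m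

InBlock : ℕ → List ℕ → ℕ → ℕ → Set
InBlock n σ m k = 1 ≤ k × k ≤ n × rep σ k ≡ m

-- the block with minimum m is nonnested: no edge (i , j) with
-- i < min B ≤ max B < j   (max B < j  written as: every element of B is < j)
Nonnested : ℕ → List ℕ → ℕ → Set
Nonnested n σ m = ∀ i j → Edge n σ i j → i < m →
  (∀ k → InBlock n σ m k → k < j) → ⊥

-- X ⊆ nonnested blocks, encoded by a Bool list of length n:
-- entry i is true iff the block with minimum i belongs to X.
IsNNSet : ℕ → List ℕ → List Bool → Set
IsNNSet n σ X =
  length X ≡ n ×
  (∀ i → atB X i ≡ true → IsBlockMin n σ i × Nonnested n σ i)

NCNNData : Set
NCNNData = List ℕ × List Bool

NCNN : ℕ → NCNNData → Set
NCNN n (σ , X) = IsPartition n σ × NonCrossing n σ × IsNNSet n σ X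

-- Ferrers diagrams of length n, encoded by their boundary word:
-- step i (1 ≤ i ≤ n) is true = south step, false = west step.
-- Rows of F are labelled by south steps i, columns by west steps j,
-- and the (i , j)-cell of F exists iff i < j.
-- Rows of the shifted diagram: pos i (row labelled i) or neg i (row labelled -i).

data Row : Set where
  pos : ℕ → Row
  neg : ℕ → Row

IsSouth : List Bool → ℕ → Set
IsSouth w i = at w i ≡ just true

IsWest : List Bool → ℕ → Set
IsWest w i = at w i ≡ just false

Cell : List Bool → Row → ℕ → Set
Cell w (pos i) j = IsSouth w i × IsWest w j × i < j
Cell w (neg i) j = IsWest w i × IsWest w j × i ≤ j

-- r' lies above r (top to bottom: -i for decreasing i, then i increasing)
Above : Row → Row → Set
Above (neg a) (neg b) = b < a
Above (neg a) (pos b) = ⊤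
Above (pos a) (neg b) = ⊥
Above (pos a) (pos b) = a < b

-- column j' is to the left of column j iff j < j'

record Tableau : Set where
  constructor tab
  field
    shape : List Bool
    fill  : Row → ℕ → Bool     -- true = 1, false = 0
open Tableau public

_≈T_ : Tableau → Tableau → Set
T ≈T T' = shape T ≡ shape T' × (∀ r j → fill T r j ≡ fill T' r j)

IsFilling : ℕ → Tableau → Set
IsFilling n T = length (shape T) ≡ n ×
  (∀ r j → fill T r j ≡ true → Cell (shape T) r j)

PTCond1 : Tableau → Set
PTCond1 T = ∀ j → IsWest (shape T) j →
  Σ Row λ r → Cell (shape T) r j × fill T r j ≡ true

PTCond2 : Tableau → Set
PTCond2 T = ∀ r j → Cell (shape T) r j → fill T r j ≡ false →
  (Σ Row λ r' → Cell (shape T) r' j × Above r' r × fill T r' j ≡ true) →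
  (Σ ℕ λ j' → Cell (shape T) r j' × j < j' × fill T r j' ≡ true) → ⊥

PTCond3 : Tableau → Set
PTCond3 T = ∀ i → Cell (shape T) (neg i) i → fill T (neg i) i ≡ false →
  (Σ ℕ λ j' → Cell (shape T) (neg i) j' × i < j' × fill T (neg i) j' ≡ true) → ⊥

PermTableauB : ℕ → Tableau → Set
PermTableauB n T = IsFilling n T × PTCond1 T × PTCond2 T × PTCond3 T

OneInEachColumn : Tableau → Set
OneInEachColumn T = ∀ j → IsWest (shape T) j →
  Σ Row λ r → Cell (shape T) r j × fill T r j ≡ true ×
    (∀ r' → Cell (shape T) r' j → fill T r' j ≡ true → r' ≡ r)

CTB : ℕ → Tableau → Set
CTB n T = PermTableauB n T × OneInEachColumn T

isMinB : List ℕ → ℕ → Bool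
isMinB σ i = rep σ i ≡ᵇ i

fShape : ℕ → NCNNData → List Bool
fShape n (σ , X) = map (λ k → isMinB σ (suc k) ∧ not (atB X (suc k))) (upTo n)

inRange : ℕ → ℕ → Bool
inRange n k = (1 ≤ᵇ k) ∧ (k ≤ᵇ n)

fFill : ℕ → NCNNData → Row → ℕ → Bool
fFill n (σ , X) (pos i) j = inRange n i ∧ inRange n j ∧ (rep σ j ≡ᵇ i) ∧ not (i ≡ᵇ j) ∧ not (atB X i)
fFill n (σ , X) (neg i) j = inRange n i ∧ inRange n j ∧ (
  ((i ≡ᵇ j) ∧ isMinB σ i ∧ atB X i) ∨
  ((rep σ j ≡ᵇ i) ∧ not (i ≡ᵇ j) ∧ atB X i))

f : ℕ → NCNNData → Tableau
f n s = tab (fShape n s) (fFill n s)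

module Submission where

-- Write R j for the minimum of the block of j.  In f(σ , X) column j carries a single
-- 1, in row −R j if the block of j is in X and in row R j otherwise; the diagonal cell
-- (−i , i) is 1 exactly for the minima i of blocks in X.  Conditions (1) and (3) are
-- then immediate, and a violation of condition (2) amounts to columns j < j' of
-- different blocks with R j' < j where either R j < R j' (the blocks cross) or
-- R j' < R j and the block of j lies in X (an X-block nested under an edge).  Both are
-- excluded by the elementwise forms of "noncrossing" and "nonnested", which follow from
-- the edge-based definitions via the existence of an edge straddling a given element.
-- Injectivity holds because the 1s of f(σ , X) record R j and membership in X.
-- Conversely, a tableau T in CT_B(n) determines R j as the label of the row of the 1
-- of column j (R j = j on south steps) and X by its diagonal; condition (2) applied to
-- suitable corners shows the resulting (σ , X) lies in NC^NN(n), and f(σ , X) = T.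

open import Defs
open import Data.Nat using (ℕ; _≤_)
open import Data.Product using (Σ; _×_)
open import Relation.Binary.PropositionalEquality using (_≡_)
open import Data.Nat using (zero; suc; _+_; _<_; _≡ᵇ_; _≤ᵇ_; z≤n; s≤s; _≟_; _<?_)
open import Data.Nat.Properties
open import Data.Bool using (Bool; true; false; _∧_; _∨_; not)
open import Data.Bool.Properties using (T-≡; ¬-not; ∧-zeroʳ; ⇔→≡)
open import Data.List using (List; []; _∷_; length; map; upTo; applyUpTo)
open import Data.List.Properties using (length-map; length-applyUpTo; map-applyUpTo)
open import Data.Maybe using (Maybe; just)
open import Data.Maybe.Properties using (just-injective)
open import Data.Product using (_,_; proj₁; proj₂; ∃)
open import Data.Unit using (tt)
open import Data.Empty using (⊥; ⊥-elim)
open import Data.Sum using (_⊎_; inj₁; inj₂)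
open import Function using (id; Equivalence; mk⇔)
open import Relation.Nullary using (¬_; Dec; yes; no)
open import Relation.Nullary.Decidable using (_×-dec_)
open import Relation.Binary.PropositionalEquality using (_≢_; refl; sym; trans; cong; cong₂; subst)
open import Relation.Binary.Definitions using (tri<; tri≈; tri>)

module _ {A : Set} where

  at-bounds : (xs : List A) (i : ℕ) {v : A} → at xs i ≡ just v → 1 ≤ i × i ≤ length xs
  at-bounds (x ∷ xs) (suc zero)    _  = s≤s z≤n , s≤s z≤n
  at-bounds (x ∷ xs) (suc (suc k)) eq = s≤s z≤n , s≤s (proj₂ (at-bounds xs (suc k) eq))

  at-defined : (xs : List A) (i : ℕ) → 1 ≤ i → i ≤ length xs → ∃ λ v → at xs i ≡ just v
  at-defined (x ∷ xs) (suc zero)    _ _        = x , refl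
  at-defined (x ∷ xs) (suc (suc k)) _ (s≤s le) = at-defined xs (suc k) (s≤s z≤n) le

  at-ext : (xs ys : List A) → length xs ≡ length ys →
    (∀ i → 1 ≤ i → i ≤ length xs → at xs i ≡ at ys i) → xs ≡ ys
  at-ext []       []       _   _ = refl
  at-ext (x ∷ xs) (y ∷ ys) len h =
    cong₂ _∷_ (just-injective (h 1 (s≤s z≤n) (s≤s z≤n)))
              (at-ext xs ys (suc-injective len) λ where
                 (suc i) _ i≤ → h (suc (suc i)) (s≤s z≤n) (s≤s i≤))

  read-ext : (read : List A → ℕ → A) →
    (∀ xs i {v} → at xs i ≡ just v → read xs i ≡ v) →
    (xs ys : List A) → length xs ≡ length ys →
    (∀ i → 1 ≤ i → i ≤ length xs → read xs i ≡ read ys i) → xs ≡ ys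
  read-ext read read-just xs ys len h = at-ext xs ys len entries
    where
    entries : ∀ i → 1 ≤ i → i ≤ length xs → at xs i ≡ at ys i
    entries i 1≤i i≤ with at-defined xs i 1≤i i≤ | at-defined ys i 1≤i (subst (i ≤_) len i≤)
    ... | v , ex | u , ey =
      trans ex (trans (cong just (trans (sym (read-just xs i ex))
                                 (trans (h i 1≤i i≤) (read-just ys i ey)))) (sym ey))

  at-applyUpTo : (h : ℕ → A) (n k : ℕ) → k < n → at (applyUpTo h n) (suc k) ≡ just (h k)
  at-applyUpTo h (suc n) zero    _         = refl
  at-applyUpTo h (suc n) (suc k) (s≤s k<n) = at-applyUpTo (λ m → h (suc m)) n k k<n

  table : (ℕ → A) → ℕ → List A
  table g n = map (λ k → g (suc k)) (upTo n)

  table-length : (g : ℕ → A) (n : ℕ) → length (table g n) ≡ n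
  table-length g n = trans (length-map _ (upTo n)) (length-applyUpTo id n)

  table-at : (g : ℕ → A) (n k : ℕ) → 1 ≤ k → k ≤ n → at (table g n) k ≡ just (g k)
  table-at g n (suc k) _ k<n =
    trans (cong (λ l → at l (suc k)) (map-applyUpTo id (λ m → g (suc m)) n))
          (at-applyUpTo (λ m → g (suc m)) n k k<n)

atℕ-just : (xs : List ℕ) (i : ℕ) {v : ℕ} → at xs i ≡ just v → atℕ xs i ≡ v
atℕ-just xs i eq with at xs i
atℕ-just xs i refl | just _ = refl

atB-just : (xs : List Bool) (i : ℕ) {v : Bool} → at xs i ≡ just v → atB xs i ≡ v
atB-just xs i eq with at xs i
atB-just xs i refl | just _ = refl

atB-true-bounds : (xs : List Bool) (i : ℕ) → atB xs i ≡ true → 1 ≤ i × i ≤ length xs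
atB-true-bounds xs i e with at xs i in eq
... | just v = at-bounds xs i eq

true≢false : true ≢ false
true≢false ()

∧-split : (a : Bool) {b : Bool} → a ∧ b ≡ true → a ≡ true × b ≡ true
∧-split true e = refl , e

∧-intro : {a b : Bool} → a ≡ true → b ≡ true → a ∧ b ≡ true
∧-intro refl refl = refl

∨-split : (a : Bool) {b : Bool} → a ∨ b ≡ true → a ≡ true ⊎ b ≡ true
∨-split true  _ = inj₁ refl
∨-split false e = inj₂ e

not-split : (a : Bool) → not a ≡ true → a ≡ false
not-split false _ = refl

not-intro : {a : Bool} → a ≡ false → not a ≡ true
not-intro refl = refl

∨-inl : {a : Bool} {b : Bool} → a ≡ true → a ∨ b ≡ true
∨-inl refl = refl

∨-inr : {a : Bool} {b : Bool} → b ≡ true → a ∨ b ≡ true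
∨-inr {true}  _    = refl
∨-inr {false} refl = refl

not-false : {a : Bool} → not a ≡ false → a ≡ true
not-false {true} _ = refl

≡ᵇ-sound : (m k : ℕ) → (m ≡ᵇ k) ≡ true → m ≡ k
≡ᵇ-sound m k e = ≡ᵇ⇒≡ m k (Equivalence.from T-≡ e)

≡ᵇ-complete : (m k : ℕ) → m ≡ k → (m ≡ᵇ k) ≡ true
≡ᵇ-complete m k e = Equivalence.to T-≡ (≡⇒≡ᵇ m k e)

≡ᵇ-false : (m k : ℕ) → m ≢ k → (m ≡ᵇ k) ≡ false
≡ᵇ-false m k m≢k = ¬-not λ e → m≢k (≡ᵇ-sound m k e)

inRange-sound : (n k : ℕ) → inRange n k ≡ true → 1 ≤ k × k ≤ n
inRange-sound n k e with ∧-split (1 ≤ᵇ k) e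
... | lo , hi = ≤ᵇ⇒≤ 1 k (Equivalence.from T-≡ lo) , ≤ᵇ⇒≤ k n (Equivalence.from T-≡ hi)

inRange-complete : (n k : ℕ) → 1 ≤ k → k ≤ n → inRange n k ≡ true
inRange-complete n k lo hi = ∧-intro (Equivalence.to T-≡ (≤⇒≤ᵇ lo)) (Equivalence.to T-≡ (≤⇒≤ᵇ hi))

-- Noncrossing and nonnesting, stated for elements instead of edges.

module Elementwise (n : ℕ) (σ : List ℕ) (noncrossing : NonCrossing n σ) where

  R : ℕ → ℕ
  R = rep σ

  StraddlingEdge : ℕ → ℕ → ℕ → Set
  StraddlingEdge x z y = Σ ℕ λ u → Σ ℕ λ v →
    Edge n σ u v × x ≤ u × u < z × z < v × v ≤ y × R x ≡ R u

  -- Induction on a bound for y − x: either (x , y) is an edge, or an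
  -- element k of the block with x < k < y shrinks the interval to [k , y] or [x , k].
  straddle : (bound x z y : ℕ) → y ≤ x + bound → 1 ≤ x → y ≤ n → x < z → z < y →
    R x ≡ R y → R x ≢ R z → StraddlingEdge x z y
  straddle zero x z y y≤x+0 _ _ x<z z<y _ _ =
    ⊥-elim (<-irrefl refl (<-≤-trans (<-trans x<z z<y) (≤-trans y≤x+0 (≤-reflexive (+-identityʳ x)))))
  straddle (suc b) x z y y≤ 1≤x y≤n x<z z<y Rxy Rxz
    with anyUpTo? (λ k → (x <? k) ×-dec (R x ≟ R k)) y
  ... | no none = x , y , edge , ≤-refl , x<z , z<y , ≤-refl , refl
    where
    edge : Edge n σ x y
    edge = 1≤x , <-trans x<z z<y , y≤n , Rxy , λ k x<k k<y Rxk → none (k , k<y , x<k , Rxk)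
  ... | yes (k , k<y , x<k , Rxk) with <-cmp k z
  ...   | tri≈ _ refl _ = ⊥-elim (Rxz Rxk)
  ...   | tri< k<z _ _
    with straddle b k z y (≤-trans y≤ (≤-trans (≤-reflexive (+-suc x b)) (+-monoˡ-≤ b x<k)))
                  (≤-trans (s≤s z≤n) x<k) y≤n k<z z<y (trans (sym Rxk) Rxy) (λ e → Rxz (trans Rxk e))
  ...     | u , v , e , k≤u , u<z , z<v , v≤y , Rku =
    u , v , e , ≤-trans (<⇒≤ x<k) k≤u , u<z , z<v , v≤y , trans Rxk Rku
  straddle (suc b) x z y y≤ 1≤x y≤n x<z z<y Rxy Rxz
      | yes (k , k<y , x<k , Rxk) | tri> _ _ z<k
    with straddle b x z k (≤-pred (≤-trans k<y (≤-trans y≤ (≤-reflexive (+-suc x b))))) 1≤x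
                  (≤-trans (<⇒≤ k<y) y≤n) x<z z<k Rxk Rxz
  ... | u , v , e , x≤u , u<z , z<v , v≤k , Rxu =
    u , v , e , x≤u , u<z , z<v , ≤-trans v≤k (<⇒≤ k<y) , Rxu

  straddlingEdge : (x z y : ℕ) → 1 ≤ x → y ≤ n → x < z → z < y →
    R x ≡ R y → R x ≢ R z → StraddlingEdge x z y
  straddlingEdge x z y = straddle y x z y (m≤n+m y x)

  edge-sameBlock : ∀ {u v} → Edge n σ u v → R u ≡ R v
  edge-sameBlock (_ , _ , _ , same , _) = same

  noncrossing-elements : (a c b d : ℕ) → a < c → c < b → b < d → 1 ≤ a → d ≤ n →
    R a ≡ R b → R c ≡ R d → R a ≢ R c → ⊥
  noncrossing-elements a c b d a<c c<b b<d 1≤a d≤n Rab Rcd Rac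
    with straddlingEdge a c b 1≤a (≤-trans (<⇒≤ b<d) d≤n) a<c c<b Rab Rac
  ... | u , v , e₁ , _ , u<c , c<v , v≤b , Rau
    with straddlingEdge c v d (≤-trans 1≤a (<⇒≤ a<c)) d≤n c<v (≤-<-trans v≤b b<d) Rcd
           (λ e → Rac (trans (trans Rau (edge-sameBlock e₁)) (sym e)))
  ... | p , q , e₂ , c≤p , p<v , v<q , _ = noncrossing u v p q e₁ e₂ (<-≤-trans u<c c≤p) p<v v<q

  nonnested-elements : (m x y : ℕ) → R m ≡ m → Nonnested n σ m → 1 ≤ x → y ≤ n →
    x < m → m < y → R x ≡ R y → R x ≢ R m → ⊥
  nonnested-elements m x y Rm nonnested 1≤x y≤n x<m m<y Rxy Rxm
    with straddlingEdge x m y 1≤x y≤n x<m m<y Rxy Rxm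
  ... | u , v , e , _ , u<m , m<v , _ , Rxu = nonnested u v e u<m below
    where
    -- the whole block of m lies below v, else a second straddling edge crosses (u , v)
    below : ∀ k → InBlock n σ m k → k < v
    below k (_ , k≤n , Rkm) with k <? v
    ... | yes k<v = k<v
    ... | no k≮v with m≤n⇒m<n∨m≡n (≮⇒≥ k≮v)
    ...   | inj₂ refl = ⊥-elim (Rxm (trans (trans Rxu (edge-sameBlock e)) (trans Rkm (sym Rm))))
    ...   | inj₁ v<k
      with straddlingEdge m v k (≤-trans 1≤x (<⇒≤ x<m)) k≤n m<v v<k (trans Rm (sym Rkm))
             (λ eq → Rxm (trans (trans Rxu (edge-sameBlock e)) (sym eq)))
    ... | p , q , e' , m≤p , p<v , v<q , _ = ⊥-elim (noncrossing u v p q e e' (<-≤-trans u<m m≤p) p<v v<q)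

-- The image f(σ , X) of an element (σ , X) of NC^NN(n) lies in CT_B(n).

module Image (n : ℕ) (σ : List ℕ) (X : List Bool) (H : NCNN n (σ , X)) where

  noncrossing : NonCrossing n σ
  noncrossing = proj₁ (proj₂ H)

  nnSet : IsNNSet n σ X
  nnSet = proj₂ (proj₂ H)

  open Elementwise n σ noncrossing

  shapeᶠ : List Bool
  shapeᶠ = fShape n (σ , X)

  entry : Row → ℕ → Bool
  entry = fFill n (σ , X)

  block-min : ∀ k → 1 ≤ k → k ≤ n → 1 ≤ R k × R k ≤ k × R (R k) ≡ R k
  block-min = proj₂ (proj₁ H)

  shape-length : length shapeᶠ ≡ n
  shape-length = table-length (λ k → isMinB σ k ∧ not (atB X k)) n

  shape-at : ∀ k → 1 ≤ k → k ≤ n → at shapeᶠ k ≡ just (isMinB σ k ∧ not (atB X k))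
  shape-at = table-at (λ k → isMinB σ k ∧ not (atB X k)) n

  step-bounds : ∀ k {b} → at shapeᶠ k ≡ just b → 1 ≤ k × k ≤ n
  step-bounds k e with at-bounds shapeᶠ k e
  ... | 1≤k , k≤ = 1≤k , subst (k ≤_) shape-length k≤

  step-value : ∀ k {b} → at shapeᶠ k ≡ just b → isMinB σ k ∧ not (atB X k) ≡ b
  step-value k e with step-bounds k e
  ... | 1≤k , k≤n = just-injective (trans (sym (shape-at k 1≤k k≤n)) e)

  west⇒ : ∀ k → IsWest shapeᶠ k → R k ≡ k → atB X k ≡ true
  west⇒ k e Rk = not-false (subst (λ b → b ∧ not (atB X k) ≡ false) (≡ᵇ-complete _ _ Rk) (step-value k e))

  south⇐ : ∀ k → 1 ≤ k → k ≤ n → R k ≡ k → atB X k ≡ false → IsSouth shapeᶠ k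
  south⇐ k 1≤k k≤n Rk Xk =
    trans (shape-at k 1≤k k≤n) (cong just (∧-intro (≡ᵇ-complete _ _ Rk) (not-intro Xk)))

  west⇐ : ∀ k → 1 ≤ k → k ≤ n → R k ≢ k ⊎ atB X k ≡ true → IsWest shapeᶠ k
  west⇐ k 1≤k k≤n h = trans (shape-at k 1≤k k≤n) (cong just (not-south h))
    where
    not-south : R k ≢ k ⊎ atB X k ≡ true → isMinB σ k ∧ not (atB X k) ≡ false
    not-south (inj₁ R≢k) = cong (_∧ not (atB X k)) (≡ᵇ-false _ _ R≢k)
    not-south (inj₂ k∈X) = trans (cong (λ b → isMinB σ k ∧ not b) k∈X) (∧-zeroʳ _)

  pos-entry⇒ : ∀ i j → entry (pos i) j ≡ true →
    (1 ≤ j × j ≤ n) × R j ≡ i × i ≢ j × atB X i ≡ false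
  pos-entry⇒ i j e =
    let _   , e₁  = ∧-split (inRange n i) e
        j∈  , e₂  = ∧-split (inRange n j) e₁
        Rj  , e₃  = ∧-split (R j ≡ᵇ i) e₂
        i≢j , i∉X = ∧-split (not (i ≡ᵇ j)) e₃
    in inRange-sound n j j∈ , ≡ᵇ-sound _ _ Rj ,
       (λ i≡j → true≢false (trans (sym (≡ᵇ-complete i j i≡j)) (not-split _ i≢j))) , not-split _ i∉X

  neg-entry⇒ : ∀ i j → entry (neg i) j ≡ true → (1 ≤ j × j ≤ n) × R j ≡ i × atB X i ≡ true
  neg-entry⇒ i j e with ∧-split (inRange n i) e
  ... | _ , e₁ with ∧-split (inRange n j) e₁
  ... | j∈ , e₂ with ∨-split ((i ≡ᵇ j) ∧ isMinB σ i ∧ atB X i) e₂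
  ... | inj₁ diagonal =
    let i≡j , e₃ = ∧-split (i ≡ᵇ j) diagonal
        Ri , i∈X = ∧-split (isMinB σ i) e₃
    in inRange-sound n j j∈ , subst (λ t → R t ≡ i) (≡ᵇ-sound _ _ i≡j) (≡ᵇ-sound _ _ Ri) , i∈X
  ... | inj₂ offDiagonal =
    let Rj , e₃ = ∧-split (R j ≡ᵇ i) offDiagonal
    in inRange-sound n j j∈ , ≡ᵇ-sound _ _ Rj , proj₂ (∧-split (not (i ≡ᵇ j)) e₃)

  block-min-inRange : ∀ j → 1 ≤ j → j ≤ n → inRange n (R j) ≡ true
  block-min-inRange j 1≤j j≤n with block-min j 1≤j j≤n
  ... | 1≤R , R≤j , _ = inRange-complete n (R j) 1≤R (≤-trans R≤j j≤n)

  pos-entry⇐ : ∀ j → 1 ≤ j → j ≤ n → R j ≢ j → atB X (R j) ≡ false → entry (pos (R j)) j ≡ true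
  pos-entry⇐ j 1≤j j≤n R≢j R∉X =
    ∧-intro (block-min-inRange j 1≤j j≤n) (∧-intro (inRange-complete n j 1≤j j≤n)
      (∧-intro (≡ᵇ-complete (R j) (R j) refl) (∧-intro (not-intro (≡ᵇ-false _ _ R≢j)) (not-intro R∉X))))

  neg-entry⇐ : ∀ j → 1 ≤ j → j ≤ n → atB X (R j) ≡ true → entry (neg (R j)) j ≡ true
  neg-entry⇐ j 1≤j j≤n R∈X =
    ∧-intro (block-min-inRange j 1≤j j≤n) (∧-intro (inRange-complete n j 1≤j j≤n) (choose (R j ≟ j)))
    where
    choose : Dec (R j ≡ j) → ((R j ≡ᵇ j) ∧ isMinB σ (R j) ∧ atB X (R j)) ∨
                             ((R j ≡ᵇ R j) ∧ not (R j ≡ᵇ j) ∧ atB X (R j)) ≡ true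
    choose (yes R≡j) = ∨-inl (∧-intro (≡ᵇ-complete _ _ R≡j)
                               (∧-intro (≡ᵇ-complete _ _ (proj₂ (proj₂ (block-min j 1≤j j≤n)))) R∈X))
    choose (no R≢j)  = ∨-inr (∧-intro (≡ᵇ-complete (R j) (R j) refl)
                               (∧-intro (not-intro (≡ᵇ-false _ _ R≢j)) R∈X))

  filled⇒cell : ∀ r j → entry r j ≡ true → Cell shapeᶠ r j
  filled⇒cell (pos i) j e with pos-entry⇒ i j e
  ... | (1≤j , j≤n) , refl , R≢j , R∉X with block-min j 1≤j j≤n
  ...   | 1≤R , R≤j , RR =
    south⇐ (R j) 1≤R (≤-trans R≤j j≤n) RR R∉X , west⇐ j 1≤j j≤n (inj₁ R≢j) , ≤∧≢⇒< R≤j R≢j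
  filled⇒cell (neg i) j e with neg-entry⇒ i j e
  ... | (1≤j , j≤n) , refl , R∈X with block-min j 1≤j j≤n
  ...   | 1≤R , R≤j , _ =
    west⇐ (R j) 1≤R (≤-trans R≤j j≤n) (inj₂ R∈X) , west⇐ j 1≤j j≤n column , R≤j
    where
    column : R j ≢ j ⊎ atB X j ≡ true
    column with R j ≟ j
    ... | yes R≡j = inj₂ (subst (λ t → atB X t ≡ true) R≡j R∈X)
    ... | no R≢j  = inj₁ R≢j

  diagonal⇐ : ∀ i → 1 ≤ i → i ≤ n → R i ≡ i → atB X i ≡ true → entry (neg i) i ≡ true
  diagonal⇐ i 1≤i i≤n Ri i∈X =
    subst (λ t → entry (neg t) i ≡ true) Ri
      (neg-entry⇐ i 1≤i i≤n (subst (λ t → atB X t ≡ true) (sym Ri) i∈X))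

  column-one : OneInEachColumn (f n (σ , X))
  column-one j west with step-bounds j west
  ... | 1≤j , j≤n with atB X (R j) in R∈?X
  ... | true = neg (R j) , filled⇒cell (neg (R j)) j one , one , unique
    where
    one : entry (neg (R j)) j ≡ true
    one = neg-entry⇐ j 1≤j j≤n R∈?X
    unique : ∀ r → Cell shapeᶠ r j → entry r j ≡ true → r ≡ neg (R j)
    unique (pos i) _ e with pos-entry⇒ i j e
    ... | _ , refl , _ , R∉X = ⊥-elim (true≢false (trans (sym R∈?X) R∉X))
    unique (neg i) _ e with neg-entry⇒ i j e
    ... | _ , refl , _ = refl
  ... | false = pos (R j) , filled⇒cell (pos (R j)) j one , one , unique
    where
    R≢j : R j ≢ j
    R≢j R≡j = true≢false (trans (sym (west⇒ j west R≡j)) (subst (λ t → atB X t ≡ false) R≡j R∈?X))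
    one : entry (pos (R j)) j ≡ true
    one = pos-entry⇐ j 1≤j j≤n R≢j R∈?X
    unique : ∀ r → Cell shapeᶠ r j → entry r j ≡ true → r ≡ pos (R j)
    unique (pos i) _ e with pos-entry⇒ i j e
    ... | _ , refl , _ = refl
    unique (neg i) _ e with neg-entry⇒ i j e
    ... | _ , refl , R∈X = ⊥-elim (true≢false (trans (sym R∈X) R∈?X))

  cond1 : PTCond1 (f n (σ , X))
  cond1 j west with column-one j west
  ... | r , cell , one , _ = r , cell , one

  -- a row −i containing a 1 belongs to a block in X, whose diagonal entry is 1
  cond3 : PTCond3 (f n (σ , X))
  cond3 i _ diag≡0 (j , _ , _ , e) with neg-entry⇒ i j e
  ... | (1≤j , j≤n) , refl , R∈X with block-min j 1≤j j≤n
  ...   | 1≤R , R≤j , RR =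
    true≢false (trans (sym (diagonal⇐ (R j) 1≤R (≤-trans R≤j j≤n) RR R∈X)) diag≡0)

  -- The elementwise content of condition (2): for columns j < j' in different blocks,
  -- the block of j' starting before j, the block of j can neither start earlier
  -- (the two blocks would cross) nor start later and belong to X (it would be nested).
  forbidden-pair : ∀ j j' → 1 ≤ j → j ≤ n → 1 ≤ j' → j' ≤ n → R j' < j → j < j' →
    R j ≢ R j' → (R j' < R j → atB X (R j) ≡ true) → ⊥
  forbidden-pair j j' 1≤j j≤n 1≤j' j'≤n R'<j j<j' R≢R' nested∈X
    with block-min j 1≤j j≤n | block-min j' 1≤j' j'≤n | <-cmp (R j) (R j')
  ... | _ | _ | tri≈ _ R≡R' _ = R≢R' R≡R'
  ... | 1≤R , _ , RR | _ , _ , RR' | tri< R<R' _ _ =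
    noncrossing-elements (R j) (R j') j j' R<R' R'<j j<j' 1≤R j'≤n RR RR'
      (λ eq → R≢R' (trans (sym RR) (trans eq RR')))
  ... | _ , R≤j , RR | 1≤R' , _ , RR' | tri> _ _ R'<R =
    nonnested-elements (R j) (R j') j' RR (proj₂ (proj₂ nnSet (R j) (nested∈X R'<R))) 1≤R' j'≤n
      R'<R (≤-<-trans R≤j j<j') RR' (λ eq → R≢R' (trans (sym RR) (trans (sym eq) RR')))

  -- a 0 at (r , j) with a 1 above it (row r' , column j) and a 1 to its left
  -- (row r , column j' > j) is exactly a forbidden pair of columns j < j'
  cond2 : PTCond2 (f n (σ , X))
  cond2 (pos I) j (_ , _ , I<j) _ (pos A , _ , A<I , e) (j' , _ , j<j' , e')
    with pos-entry⇒ A j e | pos-entry⇒ I j' e'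
  ... | (1≤j , j≤n) , refl , _ | (1≤j' , j'≤n) , refl , _ =
    forbidden-pair j j' 1≤j j≤n 1≤j' j'≤n I<j j<j' (<⇒≢ A<I) (λ I<A → ⊥-elim (<-asym A<I I<A))
  cond2 (pos I) j (_ , _ , I<j) _ (neg A , _ , _ , e) (j' , _ , j<j' , e')
    with neg-entry⇒ A j e | pos-entry⇒ I j' e'
  ... | (1≤j , j≤n) , refl , A∈X | (1≤j' , j'≤n) , refl , _ , I∉X =
    forbidden-pair j j' 1≤j j≤n 1≤j' j'≤n I<j j<j'
      (λ A≡I → true≢false (trans (sym A∈X) (trans (cong (atB X) A≡I) I∉X))) (λ _ → A∈X)
  cond2 (neg I) j _ _ (pos A , _ , () , _) _
  cond2 (neg I) j (_ , _ , I≤j) _ (neg A , _ , I<A , e) (j' , _ , j<j' , e')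
    with neg-entry⇒ A j e | neg-entry⇒ I j' e'
  ... | (1≤j , j≤n) , refl , A∈X | (1≤j' , j'≤n) , refl , _ =
    forbidden-pair j j' 1≤j j≤n 1≤j' j'≤n (≤∧≢⇒< I≤j I≢j) j<j' (>⇒≢ I<A) (λ _ → A∈X)
    where
    -- j' ∈ block of j would make the blocks of j and j' equal
    I≢j : R j' ≢ j
    I≢j R'≡j = <-irrefl (sym (trans (cong R (sym R'≡j)) (proj₂ (proj₂ (block-min j' 1≤j' j'≤n))))) I<A

  image-CTB : CTB n (f n (σ , X))
  image-CTB = ((shape-length , filled⇒cell) , cond1 , cond2 , cond3) , column-one

-- Injectivity: the row of the 1 in column j of f(σ , X) recovers the block minimum
-- of j (when j is not itself a minimum), and the diagonal recovers X.

module Recover (n : ℕ) (σ : List ℕ) (X : List Bool) (σ' : List ℕ) (X' : List Bool)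
  (H : NCNN n (σ , X)) (H' : NCNN n (σ' , X'))
  (same : ∀ r j → fFill n (σ , X) r j ≡ fFill n (σ' , X') r j) where

  module I  = Image n σ  X  H
  module I' = Image n σ' X' H'

  same-min : ∀ j → 1 ≤ j → j ≤ n → rep σ j ≢ j → rep σ' j ≡ rep σ j
  same-min j 1≤j j≤n R≢j with atB X (rep σ j) in R∈?X
  ... | true  = proj₁ (proj₂ (I'.neg-entry⇒ _ j
                  (trans (sym (same (neg (rep σ j)) j)) (I.neg-entry⇐ j 1≤j j≤n R∈?X))))
  ... | false = proj₁ (proj₂ (I'.pos-entry⇒ _ j
                  (trans (sym (same (pos (rep σ j)) j)) (I.pos-entry⇐ j 1≤j j≤n R≢j R∈?X))))

  -- a block of X is a block of X', read off the diagonal cell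
  X⊆X' : ∀ i → atB X i ≡ true → atB X' i ≡ true
  X⊆X' i i∈X with proj₂ I.nnSet i i∈X
  ... | (1≤i , i≤n , Ri) , _ =
    proj₂ (proj₂ (I'.neg-entry⇒ i i (trans (sym (same (neg i) i)) (I.diagonal⇐ i 1≤i i≤n Ri i∈X))))

injective : (n : ℕ) (s t : NCNNData) → NCNN n s → NCNN n t → f n s ≈T f n t → s ≡ t
injective n (σ , X) (σ' , X') H H' (_ , same) = cong₂ _,_ σ≡σ' X≡X'
  where
  open Recover n σ X σ' X' H H' same using (same-min; X⊆X')
  open Recover n σ' X' σ X H' H (λ r j → sym (same r j)) using ()
    renaming (same-min to same-min'; X⊆X' to X'⊆X)

  same-rep : ∀ j → 1 ≤ j → j ≤ n → rep σ j ≡ rep σ' j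
  same-rep j 1≤j j≤n with rep σ j ≟ j | rep σ' j ≟ j
  ... | no R≢j  | _        = sym (same-min j 1≤j j≤n R≢j)
  ... | yes R≡j | no R'≢j  = same-min' j 1≤j j≤n R'≢j
  ... | yes R≡j | yes R'≡j = trans R≡j (sym R'≡j)

  σ≡σ' : σ ≡ σ'
  σ≡σ' = read-ext atℕ atℕ-just σ σ' (trans (proj₁ (proj₁ H)) (sym (proj₁ (proj₁ H'))))
    λ i 1≤i i≤ → same-rep i 1≤i (subst (i ≤_) (proj₁ (proj₁ H)) i≤)

  X≡X' : X ≡ X'
  X≡X' = read-ext atB atB-just X X' (trans (proj₁ (proj₂ (proj₂ H))) (sym (proj₁ (proj₂ (proj₂ H')))))
    λ i _ _ → ⇔→≡ (mk⇔ (X⊆X' i) (X'⊆X i))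

label : Row → ℕ
label (pos i) = i
label (neg i) = i

Above-irrefl : ∀ r → ¬ Above r r
Above-irrefl (pos i) = <-irrefl refl
Above-irrefl (neg i) = <-irrefl refl

Above-total : ∀ r r' → label r ≢ label r' → Above r r' ⊎ Above r' r
Above-total (pos a) (pos b) a≢b with <-cmp a b
... | tri< a<b _ _ = inj₁ a<b
... | tri≈ _ a≡b _ = ⊥-elim (a≢b a≡b)
... | tri> _ _ b<a = inj₂ b<a
Above-total (neg a) (neg b) a≢b with <-cmp a b
... | tri< a<b _ _ = inj₂ a<b
... | tri≈ _ a≡b _ = ⊥-elim (a≢b a≡b)
... | tri> _ _ b<a = inj₁ b<a
Above-total (pos a) (neg b) _ = inj₂ tt
Above-total (neg a) (pos b) _ = inj₁ tt

above-neg : ∀ r i → label r < i → Above (neg i) r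
above-neg (pos a) i _   = tt
above-neg (neg a) i a<i = a<i

cell-west : ∀ w r k → Cell w r k → IsWest w k
cell-west w (pos i) k (_ , west , _) = west
cell-west w (neg i) k (_ , west , _) = west

cell-shift : ∀ w r k k' → Cell w r k → IsWest w k' → label r < k' → Cell w r k'
cell-shift w (pos i) k k' (south , _ , _) west i<k' = south , west , i<k'
cell-shift w (neg i) k k' (i-west , _ , _) west i<k' = i-west , west , <⇒≤ i<k'

ones-ext : (T T' : Tableau) → shape T ≡ shape T' →
  (∀ r j → fill T' r j ≡ true → Cell (shape T') r j) → PTCond1 T → OneInEachColumn T' →
  (∀ r j → fill T r j ≡ true → fill T' r j ≡ true) → ∀ r j → fill T r j ≡ fill T' r j
ones-ext T T' same-shape cells' column column' ones⊆ r j = ⇔→≡ (mk⇔ (ones⊆ r j) back)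
  where
  back : fill T' r j ≡ true → fill T r j ≡ true
  back e' with column j (subst (λ w → IsWest w j) (sym same-shape) (cell-west _ r j (cells' r j e')))
  ... | r₀ , _ , e₀ with column' j (cell-west _ r j (cells' r j e'))
  ...   | _ , _ , _ , unique =
    subst (λ t → fill T t j ≡ true)
      (trans (unique r₀ (cells' r₀ j (ones⊆ r₀ j e₀)) (ones⊆ r₀ j e₀))
             (sym (unique r (cells' r j e') e'))) e₀

-- Surjectivity: T ∈ CT_B(n) is f(σ , X), where the block minimum g j of a west step
-- j is the label of the row of the unique 1 in column j (a south step is its own
-- minimum), and X marks the i whose diagonal cell (−i , i) holds a 1.

module Preimage (n : ℕ) (T : Tableau) (ctb : CTB n T) where

  w : List Bool
  w = shape T

  fl : Row → ℕ → Bool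
  fl = fill T

  length-w : length w ≡ n
  length-w = proj₁ (proj₁ (proj₁ ctb))

  cell-of-one : ∀ r j → fl r j ≡ true → Cell w r j
  cell-of-one = proj₂ (proj₁ (proj₁ ctb))

  cond1 : PTCond1 T
  cond1 = proj₁ (proj₂ (proj₁ ctb))

  cond2 : PTCond2 T
  cond2 = proj₁ (proj₂ (proj₂ (proj₁ ctb)))

  cond3 : PTCond3 T
  cond3 = proj₂ (proj₂ (proj₂ (proj₁ ctb)))

  one : OneInEachColumn T
  one = proj₂ ctb

  step-bounds : ∀ k {b} → at w k ≡ just b → 1 ≤ k × k ≤ n
  step-bounds k e with at-bounds w k e
  ... | 1≤k , k≤ = 1≤k , subst (k ≤_) length-w k≤

  south≢west : ∀ k → IsSouth w k → IsWest w k → ⊥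
  south≢west k south west = true≢false (just-injective (trans (sym south) west))

  step-kind : ∀ k → 1 ≤ k → k ≤ n → IsSouth w k ⊎ IsWest w k
  step-kind k 1≤k k≤n with at-defined w k 1≤k (subst (k ≤_) (sym length-w) k≤n)
  ... | true  , e = inj₁ e
  ... | false , e = inj₂ e

  one-row : ∀ r r' k → fl r k ≡ true → fl r' k ≡ true → r ≡ r'
  one-row r r' k e e' with one k (cell-west w r k (cell-of-one r k e))
  ... | _ , _ , _ , unique =
    trans (unique r (cell-of-one r k e) e) (sym (unique r' (cell-of-one r' k e') e'))

  -- a row −i containing a 1 has its 1 on the diagonal too (condition (3))
  diagonal : ∀ i k → fl (neg i) k ≡ true → fl (neg i) i ≡ true
  diagonal i k e with fl (neg i) i in d
  ... | true  = refl
  ... | false with cell-of-one (neg i) k e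
  ...   | i-west , k-west , i≤k with m≤n⇒m<n∨m≡n i≤k
  ...     | inj₂ refl = ⊥-elim (true≢false (trans (sym e) d))
  ...     | inj₁ i<k  =
    ⊥-elim (cond3 i (i-west , i-west , ≤-refl) d (k , (i-west , k-west , i≤k) , i<k , e))

  -- the block minimum of k, read off the step (and column) k
  g-at : (k : ℕ) (m : Maybe Bool) → at w k ≡ m → ℕ
  g-at k (just false) west = label (proj₁ (one k west))
  g-at k _            _    = k

  g : ℕ → ℕ
  g k = g-at k (at w k) refl

  g-one : ∀ r k → fl r k ≡ true → g k ≡ label r
  g-one r k e = spec (at w k) refl (cell-west w r k (cell-of-one r k e))
    where
    spec : (m : Maybe Bool) (eq : at w k ≡ m) → m ≡ just false → g-at k m eq ≡ label r
    spec (just false) west _ =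
      cong label (sym (proj₂ (proj₂ (proj₂ (one k west))) r (cell-of-one r k e) e))

  g-south : ∀ k → IsSouth w k → g k ≡ k
  g-south k south = spec (at w k) refl south
    where
    spec : (m : Maybe Bool) (eq : at w k ≡ m) → m ≡ just true → g-at k m eq ≡ k
    spec (just true) _ _ = refl

  column-one : ∀ k → IsWest w k → Σ Row λ r → fl r k ≡ true
  column-one k west with one k west
  ... | r , _ , e , _ = r , e

  row-label : ∀ r k → fl r k ≡ true → g (label r) ≡ label r × 1 ≤ label r × label r ≤ k
  row-label (pos i) k e with cell-of-one (pos i) k e
  ... | south , _ , i<k = g-south i south , proj₁ (step-bounds i south) , <⇒≤ i<k
  row-label (neg i) k e with cell-of-one (neg i) k e
  ... | i-west , _ , i≤k = g-one (neg i) i (diagonal i k e) , proj₁ (step-bounds i i-west) , i≤k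

  g-min : ∀ k → 1 ≤ k → k ≤ n → 1 ≤ g k × g k ≤ k × g (g k) ≡ g k
  g-min k 1≤k k≤n with step-kind k 1≤k k≤n
  ... | inj₁ south =
    subst (λ t → 1 ≤ t × t ≤ k × g t ≡ t) (sym (g-south k south)) (1≤k , ≤-refl , g-south k south)
  ... | inj₂ west with column-one k west
  ...   | r , e with row-label r k e
  ...     | fixed , 1≤ , ≤k = subst (λ t → 1 ≤ t × t ≤ k × g t ≡ t) (sym (g-one r k e)) (1≤ , ≤k , fixed)

  nonmin-column : ∀ k → 1 ≤ k → k ≤ n → g k ≢ k → Σ Row λ r → fl r k ≡ true × g k ≡ label r
  nonmin-column k 1≤k k≤n gk≢k with step-kind k 1≤k k≤n
  ... | inj₁ south = ⊥-elim (gk≢k (g-south k south))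
  ... | inj₂ west with column-one k west
  ...   | r , e = r , e , g-one r k e

  -- two rows with 1s and the same label coincide (i and −i cannot both be rows with 1s)
  same-label-row : ∀ r r' x y → fl r x ≡ true → fl r' y ≡ true → label r ≡ label r' → r ≡ r'
  same-label-row (pos i) (pos .i) _ _ _ _ refl = refl
  same-label-row (neg i) (neg .i) _ _ _ _ refl = refl
  same-label-row (pos i) (neg .i) x y e e' refl =
    ⊥-elim (south≢west i (proj₁ (cell-of-one _ x e)) (proj₁ (cell-of-one _ y e')))
  same-label-row (neg i) (pos .i) x y e e' refl =
    ⊥-elim (south≢west i (proj₁ (cell-of-one _ y e')) (proj₁ (cell-of-one _ x e)))

  -- a 1 in column k whose row has label k is the diagonal entry (−k , k): row k ends before column k
  min-column-diagonal : ∀ r k → fl r k ≡ true → label r ≡ k → fl (neg k) k ≡ true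
  min-column-diagonal (pos i) k e i≡k = ⊥-elim (<-irrefl i≡k (proj₂ (proj₂ (cell-of-one (pos i) k e))))
  min-column-diagonal (neg i) k e refl = e

  -- Condition (2) with one 1 per column: if the 1 of column x lies in a row r' above
  -- row r, and row r has a 1 in a column y > x, then (r , x) is not a cell.
  corner : ∀ r r' x y → fl r' x ≡ true → Above r' r → fl r y ≡ true → x < y → label r < x → ⊥
  corner r r' x y e' r'↑r e x<y r<x =
    cond2 r x cell empty (r' , cell-of-one r' x e' , r'↑r , e') (y , cell-of-one r y e , x<y , e)
    where
    cell : Cell w r x
    cell = cell-shift w r y x (cell-of-one r y e) (cell-west w r' x (cell-of-one r' x e')) r<x
    empty : fl r x ≡ false
    empty = ¬-not λ e₀ → Above-irrefl r (subst (λ t → Above t r) (one-row r' r x e' e₀) r'↑r)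

  one-in-row : ∀ r r' y c → 1 ≤ c → c ≤ n → fl r y ≡ true → g c ≡ label r →
    Above r r' → label r' < c → fl r c ≡ true
  one-in-row r r' y c 1≤c c≤n e gc _ _ with g c ≟ c
  one-in-row r r' y c 1≤c c≤n e gc _ _ | no gc≢c with nonmin-column c 1≤c c≤n gc≢c
  ... | rc , ec , gc' = subst (λ t → fl t c ≡ true) (same-label-row rc r c y ec e (trans (sym gc') gc)) ec
  one-in-row (neg i) r' y c _ _ e gc _ _ | yes gc≡c =
    subst (λ t → fl (neg i) t ≡ true) (trans (sym gc) gc≡c) (diagonal i y e)
  one-in-row (pos i) (pos a) y c _ _ e gc i<a a<c | yes gc≡c =
    ⊥-elim (<-asym i<a (subst (a <_) (trans (sym gc≡c) gc) a<c))
  one-in-row (pos i) (neg a) y c _ _ e gc () _ | yes _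

  σ : List ℕ
  σ = table g n

  X : List Bool
  X = table (λ k → fl (neg k) k) n

  rep-σ : ∀ k → 1 ≤ k → k ≤ n → rep σ k ≡ g k
  rep-σ k 1≤k k≤n = atℕ-just σ k (table-at g n k 1≤k k≤n)

  X-at : ∀ k → 1 ≤ k → k ≤ n → atB X k ≡ fl (neg k) k
  X-at k 1≤k k≤n = atB-just X k (table-at (λ k → fl (neg k) k) n k 1≤k k≤n)

  rep-one : ∀ r j → fl r j ≡ true → rep σ j ≡ label r
  rep-one r j e with step-bounds j (cell-west w r j (cell-of-one r j e))
  ... | 1≤j , j≤n = trans (rep-σ j 1≤j j≤n) (g-one r j e)

  neg-row∈X : ∀ i j → fl (neg i) j ≡ true → atB X i ≡ true
  neg-row∈X i j e with step-bounds i (proj₁ (cell-of-one (neg i) j e))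
  ... | 1≤i , i≤n = trans (X-at i 1≤i i≤n) (diagonal i j e)

  south∉X : ∀ i → IsSouth w i → atB X i ≡ false
  south∉X i south with step-bounds i south
  ... | 1≤i , i≤n =
    trans (X-at i 1≤i i≤n) (¬-not λ diag → south≢west i south (proj₁ (cell-of-one (neg i) i diag)))

  partition : IsPartition n σ
  partition = table-length g n , blocks
    where
    blocks : ∀ k → 1 ≤ k → k ≤ n → 1 ≤ rep σ k × rep σ k ≤ k × rep σ (rep σ k) ≡ rep σ k
    blocks k 1≤k k≤n with g-min k 1≤k k≤n
    ... | 1≤ , ≤k , fixed = subst (λ t → 1 ≤ t × t ≤ k × rep σ t ≡ t) (sym (rep-σ k 1≤k k≤n))
                              (1≤ , ≤k , trans (rep-σ (g k) 1≤ (≤-trans ≤k k≤n)) fixed)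

  edge-one : ∀ a b → Edge n σ a b → (Σ Row λ r → fl r b ≡ true × label r ≡ g a) × g a ≤ a
  edge-one a b (1≤a , a<b , b≤n , same , _) = row (nonmin-column b 1≤b b≤n gb≢b) , ga≤a
    where
    1≤b : 1 ≤ b
    1≤b = ≤-trans 1≤a (<⇒≤ a<b)
    a≤n : a ≤ n
    a≤n = ≤-trans (<⇒≤ a<b) b≤n
    ga≡gb : g a ≡ g b
    ga≡gb = trans (sym (rep-σ a 1≤a a≤n)) (trans same (rep-σ b 1≤b b≤n))
    ga≤a : g a ≤ a
    ga≤a = proj₁ (proj₂ (g-min a 1≤a a≤n))
    gb≢b : g b ≢ b
    gb≢b gb≡b = <-irrefl gb≡b (≤-<-trans (subst (_≤ a) ga≡gb ga≤a) a<b)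
    row : (Σ Row λ r → fl r b ≡ true × g b ≡ label r) → Σ Row λ r → fl r b ≡ true × label r ≡ g a
    row (r , e , gb≡r) = r , e , trans (sym gb≡r) (sym ga≡gb)

  -- Crossing edges (a , b), (c , d) with a < c < b < d: the 1s of columns b and d lie
  -- in rows r_b , r_d labelled g a , g c.  If r_b is above r_d, the cell (r_d , b) breaks
  -- condition (2); otherwise the 1 of column c is in row r_d and (r_b , c) breaks it.
  noncrossing : NonCrossing n σ
  noncrossing a b c d ab cd a<c c<b b<d = crossing (edge-one a b ab) (edge-one c d cd)
    where
    1≤c : 1 ≤ c
    1≤c = proj₁ cd
    c≤n : c ≤ n
    c≤n = ≤-trans (<⇒≤ (proj₁ (proj₂ cd))) (proj₁ (proj₂ (proj₂ cd)))
    -- c lies strictly inside the edge (a , b), so not in its block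
    ga≢gc : g a ≢ g c
    ga≢gc ga≡gc = proj₂ (proj₂ (proj₂ (proj₂ ab))) c a<c c<b
      (trans (rep-σ a (proj₁ ab) (≤-trans (<⇒≤ (<-trans a<c c<b)) (proj₁ (proj₂ (proj₂ ab)))))
        (trans ga≡gc (sym (rep-σ c 1≤c c≤n))))
    crossing : (Σ Row λ r → fl r b ≡ true × label r ≡ g a) × g a ≤ a →
               (Σ Row λ r → fl r d ≡ true × label r ≡ g c) × g c ≤ c → ⊥
    crossing ((rb , eb , lb) , ga≤a) ((rd , ed , ld) , gc≤c)
      with Above-total rb rd (λ eq → ga≢gc (trans (sym lb) (trans eq ld)))
    ... | inj₁ rb↑rd = corner rd rb b d eb rb↑rd ed b<d (subst (_< b) (sym ld) (≤-<-trans gc≤c c<b))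
    ... | inj₂ rd↑rb = corner rb rd c b ec rd↑rb eb c<b rb<c
      where
      rb<c : label rb < c
      rb<c = subst (_< c) (sym lb) (≤-<-trans ga≤a a<c)
      ec : fl rd c ≡ true
      ec = one-in-row rd rb d c 1≤c c≤n ed (sym ld) rd↑rb rb<c

  -- A block i in X (diagonal 1 at (−i , i)) is nonnested: for an edge (a , b) with
  -- a < i < b, the row r_b of the 1 in column b is below −i, and (r_b , i) breaks (2).
  nonnested : ∀ i → 1 ≤ i → i ≤ n → fl (neg i) i ≡ true → Nonnested n σ i
  nonnested i 1≤i i≤n diag a b ab a<i below with edge-one a b ab
  ... | (rb , eb , lb) , ga≤a =
    corner rb (neg i) i b diag (above-neg rb i rb<i) eb (below i (1≤i , i≤n , rep-one (neg i) i diag)) rb<i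
    where
    rb<i : label rb < i
    rb<i = subst (_< i) (sym lb) (≤-<-trans ga≤a a<i)

  nnSet : IsNNSet n σ X
  nnSet = table-length (λ k → fl (neg k) k) n , blocks
    where
    blocks : ∀ i → atB X i ≡ true → IsBlockMin n σ i × Nonnested n σ i
    blocks i i∈X with atB-true-bounds X i i∈X
    ... | 1≤i , i≤ = (1≤i , i≤n , rep-one (neg i) i diag) , nonnested i 1≤i i≤n diag
      where
      i≤n : i ≤ n
      i≤n = subst (i ≤_) (table-length (λ k → fl (neg k) k) n) i≤
      diag : fl (neg i) i ≡ true
      diag = trans (sym (X-at i 1≤i i≤n)) i∈X

  preimage-NCNN : NCNN n (σ , X)
  preimage-NCNN = partition , noncrossing , nnSet

  module F = Image n σ X preimage-NCNN

  -- f(σ , X) has the shape of T: south steps are exactly the minima outside X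
  shape-eq : fShape n (σ , X) ≡ w
  shape-eq = at-ext _ w (trans F.shape-length (sym length-w))
    λ k 1≤k k≤ → step k 1≤k (subst (k ≤_) F.shape-length k≤)
    where
    step : ∀ k → 1 ≤ k → k ≤ n → at F.shapeᶠ k ≡ at w k
    step k 1≤k k≤n with step-kind k 1≤k k≤n
    ... | inj₁ south =
      trans (F.south⇐ k 1≤k k≤n (trans (rep-σ k 1≤k k≤n) (g-south k south)) (south∉X k south)) (sym south)
    ... | inj₂ west = trans (F.west⇐ k 1≤k k≤n nonmin-or-X) (sym west)
      where
      nonmin-or-X : rep σ k ≢ k ⊎ atB X k ≡ true
      nonmin-or-X with g k ≟ k | column-one k west
      ... | no gk≢k  | _     = inj₁ λ eq → gk≢k (trans (sym (rep-σ k 1≤k k≤n)) eq)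
      ... | yes gk≡k | r , e =
        inj₂ (neg-row∈X k k (min-column-diagonal r k e (trans (sym (g-one r k e)) gk≡k)))

  ones-preserved : ∀ r j → fl r j ≡ true → F.entry r j ≡ true
  ones-preserved (pos i) j e with cell-of-one (pos i) j e
  ... | south , west , i<j with step-bounds j west
  ...   | 1≤j , j≤n =
    subst (λ t → F.entry (pos t) j ≡ true) (rep-one (pos i) j e)
      (F.pos-entry⇐ j 1≤j j≤n (λ eq → <-irrefl (trans (sym (rep-one (pos i) j e)) eq) i<j)
        (subst (λ t → atB X t ≡ false) (sym (rep-one (pos i) j e)) (south∉X i south)))
  ones-preserved (neg i) j e with step-bounds j (proj₁ (proj₂ (cell-of-one (neg i) j e)))
  ... | 1≤j , j≤n =
    subst (λ t → F.entry (neg t) j ≡ true) (rep-one (neg i) j e)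
      (F.neg-entry⇐ j 1≤j j≤n
        (subst (λ t → atB X t ≡ true) (sym (rep-one (neg i) j e)) (neg-row∈X i j e)))

  preimage : Σ NCNNData λ s → NCNN n s × f n s ≈T T
  preimage = (σ , X) , preimage-NCNN , shape-eq , λ r j →
    sym (ones-ext T (f n (σ , X)) (sym shape-eq) F.filled⇒cell cond1 F.column-one ones-preserved r j)

theorem8p1 : (n : ℕ) → 1 ≤ n →
    ((s : NCNNData) → NCNN n s → CTB n (f n s)) ×
    ((s t : NCNNData) → NCNN n s → NCNN n t → f n s ≈T f n t → s ≡ t) ×
    ((T : Tableau) → CTB n T → Σ NCNNData λ s → NCNN n s × f n s ≈T T)
theorem8p1 n _ =
  (λ { (σ , X) H → Image.image-CTB n σ X H }) ,
  injective n ,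
  (λ T ctb → Preimage.preimage n T ctb)
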